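{- Let $\mathcal{B}_{\mathcal{P}_1}$ be the set of partitions $\lambda=(\lambda_1,\ldots,\lambda_\ell)$ with $\ell\ge1$ whose even-indexed parts are even, which satisfy $0\le\lambda_i-\lambda_{i+1}\le1$ for $1\le i<\ell$, and whose smallest part satisfies $\lambda_\ell\in\{1,2\}$. For integers $m\ge1$ and $h$, let $B_{\mathcal{P}_1}(m,h)=\sum\omega(\lambda)$, the sum over $\lambda\in\mathcal{B}_{\mathcal{P}_1}$ with $\ell(\lambda)=m$ and $\lambda_1=h$. Then for all positive integers $n$ and $h$: $$B_{\mathcal{P}_1}(2n,2h)=a^{h-1}Q^{\binom{h}{2}+n}{n-1\brack h-1}_{Q},\qquad B_{\mathcal{P}_1}(2n+1,2h)=(1+b)a^{h}Q^{\binom{h}{2}+n}{n-1\brack h-1}_{Q},$$ $$B_{\mathcal{P}_1}(2n,2h-1)=a^{h-1}Q^{\binom{h-1}{2}+n}{n-1\brack h-2}_{Q},\qquad B_{\mathcal{P}_1}(2n+1,2h-1)=(1+b)a^{h}Q^{\binom{h-1}{2}+n}{n-1\brack h-2}_{Q}.$$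
   Context: Partitions are finite weakly decreasing sequences of positive integers; $\ell(\lambda)$ is the length and $\lambda_i=0$ for $i>\ell(\lambda)$. The four-parameter weight is $\omega(\lambda)=a^{\sum_{i\ge1}\lceil\lambda_{2i-1}/2\rceil}b^{\sum_{i\ge1}\lfloor\lambda_{2i-1}/2\rfloor}c^{\sum_{i\ge1}\lceil\lambda_{2i}/2\rceil}d^{\sum_{i\ge1}\lfloor\lambda_{2i}/2\rfloor}$, and $Q=abcd$. The $Q$-binomial coefficient is ${N\brack k}_Q=\frac{(Q;Q)_N}{(Q;Q)_k(Q;Q)_{N-k}}$ for $0\le k\le N$ and $0$ otherwise, where $(Q;Q)_N=\prod_{i=1}^{N}(1-Q^i)$; $\binom{m}{2}=m(m-1)/2$. -}

module Defs where

open import Level using (Level)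
open import Data.Bool using (Bool; true; false; _∧_; _∨_; if_then_else_)
open import Data.Nat using (ℕ; zero; suc; _∸_; ⌊_/2⌋; ⌈_/2⌉; _≡ᵇ_; _≤ᵇ_)
open import Data.Integer using (ℤ; +_; -[1+_])
open import Data.List using (List; []; _∷_; map; concatMap; upTo; filter; foldr; last)
open import Data.Maybe using (Maybe; just; nothing)
open import Algebra.Bundles using (CommutativeRing)

isEven : ℕ → Bool
isEven zero          = true
isEven (suc zero)    = false
isEven (suc (suc n)) = isEven n

allPos : List ℕ → Bool
allPos []       = true
allPos (x ∷ xs) = (1 ≤ᵇ x) ∧ allPos xs

-- parts at even (1-based) positions are even.  The flag says whether the
-- head of the current list sits at an odd position.
evenIdxEvenFrom : Bool → List ℕ → Bool
evenIdxEvenFrom _     []       = true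
evenIdxEvenFrom true  (x ∷ xs) = evenIdxEvenFrom false xs
evenIdxEvenFrom false (x ∷ xs) = isEven x ∧ evenIdxEvenFrom true xs

evenIdxEven : List ℕ → Bool
evenIdxEven = evenIdxEvenFrom true

diffsOK : List ℕ → Bool
diffsOK []             = true
diffsOK (x ∷ [])       = true
diffsOK (x ∷ y ∷ xs)   = ((x ≡ᵇ y) ∨ (x ≡ᵇ suc y)) ∧ diffsOK (y ∷ xs)

-- smallest (last) part is 1 or 2; false for the empty list (ℓ ≥ 1)
lastOK : List ℕ → Bool
lastOK xs with last xs
... | nothing = false
... | just x  = (x ≡ᵇ 1) ∨ (x ≡ᵇ 2)

inBP1 : List ℕ → Bool
inBP1 λs = allPos λs ∧ evenIdxEven λs ∧ diffsOK λs ∧ lastOK λs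

firstIs : ℕ → List ℕ → Bool
firstIs h []      = false
firstIs h (x ∷ _) = x ≡ᵇ h

listsUpTo : ℕ → ℕ → List (List ℕ)
listsUpTo zero    h = [] ∷ []
listsUpTo (suc m) h = concatMap (λ x → map (x ∷_) (listsUpTo m h)) (upTo (suc h))

-- the (finite) set of λ ∈ B_{P_1} with ℓ(λ) = m and λ_1 = h
-- (every such λ has all parts ≤ λ_1 = h, so it occurs in listsUpTo m h)
BP1lists : ℕ → ℕ → List (List ℕ)
BP1lists m h = filter (λ λs → (inBP1 λs ∧ firstIs h λs) Data.Bool.≟ true) (listsUpTo m h)

-- Ring part: everything is computed in an arbitrary commutative ring R
-- with chosen elements a b c d (so identities are polynomial identities).

module WithRing {c ℓ : Level} (R : CommutativeRing c ℓ) where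
  open CommutativeRing R

  pow : Carrier → ℕ → Carrier
  pow x zero    = 1#
  pow x (suc n) = x * pow x n

  module Params (a b c' d : Carrier) where

    Q : Carrier
    Q = a * b * c' * d

    ωFrom : Bool → List ℕ → Carrier
    ωFrom _     []       = 1#
    ωFrom true  (x ∷ xs) = pow a ⌈ x /2⌉ * pow b ⌊ x /2⌋ * ωFrom false xs
    ωFrom false (x ∷ xs) = pow c' ⌈ x /2⌉ * pow d ⌊ x /2⌋ * ωFrom true xs

    ω : List ℕ → Carrier
    ω = ωFrom true

    B : ℕ → ℕ → Carrier
    B m h = foldr (λ λs acc → ω λs + acc) 0# (BP1lists m h)

    gauss : ℕ → ℕ → Carrier
    gauss N       zero    = 1#
    gauss zero    (suc k) = 0#
    gauss (suc N) (suc k) = gauss N k + pow Q (suc k) * gauss N (suc k)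

    qbin : ℕ → ℤ → Carrier
    qbin N (+ k)      = gauss N k
    qbin N -[1+ k ]   = 0#

{-# OPTIONS --safe #-}
-- A partition in B_{P_1} is a chain whose consecutive parts drop by 0 or 1, so B obeys a
-- transfer recursion in the current part and the parity of its position (chainSum).
-- A part 2k or 2k+1 at an odd position must be followed by 2k, hence starting with 2k+1
-- instead of 2k multiplies the weight by a; and a chain starting 2k+2, 2k+2 picks up
-- (ab)^(k+1) (cd)^(k+1) = Q^(k+1) before continuing from 2k+1 or 2k+2.  For
-- O(k, j) = B(2j+2, 2k) this gives O(k+1, j+1) = Q^(k+1) (a O(k, j) + O(k+1, j)),
-- a Q-Pascal recurrence solved by O(k+1, j) = a^k Q^(C(k+1,2)+j+1) [j, k]_Q.
-- A chain of even length ends in 2, so appending one more part (1 or 2) multiplies B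
-- by a + ab = (1+b) a.
module Submission where

open import Defs
open import Level using (Level)
open import Function using (_∘_)
open import Data.Bool using (Bool; true; false; not; _∧_; _∨_; if_then_else_; _≟_)
open import Data.Bool.Properties using (∧-assoc; ∧-comm; ∧-zeroʳ; ∧-identityʳ; ∧-commutativeMonoid)
open import Data.List using (List; []; _∷_; _++_; map; concatMap; applyUpTo; filter; foldr; last)
open import Data.Maybe using (just; nothing)
open import Data.Nat using (ℕ; zero; suc; _∸_; _<_; _≤_; s≤s; _≡ᵇ_; _≤ᵇ_; ⌊_/2⌋; ⌈_/2⌉) renaming (_+_ to _+ℕ_; _*_ to _*ℕ_)
import Data.Nat.Properties as ℕ
open import Data.Nat.Combinatorics using (_C_; nC1≡n; nCk+nC[k+1]≡[n+1]C[k+1])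
open import Data.Integer using (+_) renaming (_-_ to _-ℤ_)
open import Data.Product using (_×_; _,_)
open import Algebra.Bundles using (CommutativeRing; CommutativeMonoid)
open import Relation.Binary.PropositionalEquality as ≡ using (_≡_)
import Algebra.Properties.CommutativeSemigroup as CommSemigroupProperties

double : ℕ → ℕ
double zero    = zero
double (suc n) = suc (suc (double n))

2*n≡double : ∀ n → 2 *ℕ n ≡ double n
2*n≡double zero    = ≡.refl
2*n≡double (suc n) = ≡.cong suc (≡.trans (ℕ.+-suc n (n +ℕ 0)) (≡.cong suc (2*n≡double n)))

2*n+1≡1+double : ∀ n → 2 *ℕ n +ℕ 1 ≡ suc (double n)
2*n+1≡1+double n = ≡.trans (ℕ.+-comm (2 *ℕ n) 1) (≡.cong suc (2*n≡double n))

isEven-double : ∀ n → isEven (double n) ≡ true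
isEven-double zero    = ≡.refl
isEven-double (suc n) = isEven-double n

isEven-1+double : ∀ n → isEven (suc (double n)) ≡ false
isEven-1+double zero    = ≡.refl
isEven-1+double (suc n) = isEven-1+double n

⌊double/2⌋≡n : ∀ n → ⌊ double n /2⌋ ≡ n
⌊double/2⌋≡n zero    = ≡.refl
⌊double/2⌋≡n (suc n) = ≡.cong suc (⌊double/2⌋≡n n)

⌊1+double/2⌋≡n : ∀ n → ⌊ suc (double n) /2⌋ ≡ n
⌊1+double/2⌋≡n zero    = ≡.refl
⌊1+double/2⌋≡n (suc n) = ≡.cong suc (⌊1+double/2⌋≡n n)

C2-shift : ∀ n m → suc n C 2 +ℕ m ≡ n +ℕ (n C 2 +ℕ m)
C2-shift n m = ≡.trans (≡.cong (_+ℕ m) [1+n]C2≡n+nC2) (ℕ.+-assoc n (n C 2) m)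
  where
  [1+n]C2≡n+nC2 : suc n C 2 ≡ n +ℕ n C 2
  [1+n]C2≡n+nC2 = ≡.trans (≡.sym (nCk+nC[k+1]≡[n+1]C[k+1] n 1)) (≡.cong (_+ℕ n C 2) (nC1≡n n))

validFrom : Bool → List ℕ → Bool
validFrom f xs = allPos xs ∧ evenIdxEvenFrom f xs ∧ diffsOK xs ∧ lastOK xs

parityOK : Bool → ℕ → Bool
parityOK true  x = true
parityOK false x = isEven x

linkOK : Bool → ℕ → ℕ → Bool
linkOK f x y = (1 ≤ᵇ x) ∧ parityOK f x ∧ ((x ≡ᵇ y) ∨ (x ≡ᵇ suc y))

evenIdxEvenFrom-∷ : ∀ f x xs → evenIdxEvenFrom f (x ∷ xs) ≡ parityOK f x ∧ evenIdxEvenFrom (not f) xs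
evenIdxEvenFrom-∷ true  x xs = ≡.refl
evenIdxEvenFrom-∷ false x xs = ≡.refl

lastOK-∷∷ : ∀ x y zs → lastOK (x ∷ y ∷ zs) ≡ lastOK (y ∷ zs)
lastOK-∷∷ x y zs with last (y ∷ zs)
... | nothing = ≡.refl
... | just _  = ≡.refl

validFrom-∷∷ : ∀ f x y zs → validFrom f (x ∷ y ∷ zs) ≡ linkOK f x y ∧ validFrom (not f) (y ∷ zs)
validFrom-∷∷ f x y zs = begin
  (p ∧ P) ∧ evenIdxEvenFrom f (x ∷ y ∷ zs) ∧ (r ∧ D) ∧ lastOK (x ∷ y ∷ zs)
    ≡⟨ ≡.cong₂ (λ e l → (p ∧ P) ∧ e ∧ (r ∧ D) ∧ l) (evenIdxEvenFrom-∷ f x (y ∷ zs)) (lastOK-∷∷ x y zs) ⟩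
  (p ∧ P) ∧ (e ∧ E) ∧ (r ∧ D) ∧ L
    ≡⟨ ≡.cong (λ t → (p ∧ P) ∧ (e ∧ E) ∧ t) (∧-assoc r D L) ⟩
  (p ∧ P) ∧ (e ∧ E) ∧ r ∧ D ∧ L
    ≡⟨ ≡.cong ((p ∧ P) ∧_) (interchange e E r (D ∧ L)) ⟩
  (p ∧ P) ∧ (e ∧ r) ∧ E ∧ D ∧ L
    ≡⟨ interchange p P (e ∧ r) (E ∧ D ∧ L) ⟩
  (p ∧ e ∧ r) ∧ P ∧ E ∧ D ∧ L
    ∎
  where
  open ≡.≡-Reasoning
  open CommSemigroupProperties (CommutativeMonoid.commutativeSemigroup ∧-commutativeMonoid) using (interchange)
  p e r P E D L : Bool
  p = 1 ≤ᵇ x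
  e = parityOK f x
  r = (x ≡ᵇ y) ∨ (x ≡ᵇ suc y)
  P = allPos (y ∷ zs)
  E = evenIdxEvenFrom (not f) (y ∷ zs)
  D = diffsOK (y ∷ zs)
  L = lastOK (y ∷ zs)

module Sums {c ℓ : Level} (R : CommutativeRing c ℓ) where
  open CommutativeRing R

  if-congʳ : ∀ b {x y} → x ≈ y → (if b then x else 0#) ≈ (if b then y else 0#)
  if-congʳ true  x≈y = x≈y
  if-congʳ false x≈y = refl

  if-true : ∀ {b x} → b ≡ true → (if b then x else 0#) ≈ x
  if-true ≡.refl = refl

  if-≈0 : ∀ b {x} → x ≈ 0# → (if b then x else 0#) ≈ 0#
  if-≈0 true  x≈0 = x≈0
  if-≈0 false x≈0 = refl

  if-false : ∀ {b x} → b ≡ false → (if b then x else 0#) ≈ 0#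
  if-false ≡.refl = refl

  sumWhere : {A : Set} → (A → Bool) → (A → Carrier) → List A → Carrier
  sumWhere p g []       = 0#
  sumWhere p g (x ∷ xs) = if p x then g x + sumWhere p g xs else sumWhere p g xs

  module _ {A : Set} where

    foldr-filter≡sumWhere : ∀ (p : A → Bool) g xs →
      foldr (λ x acc → g x + acc) 0# (filter (λ x → p x ≟ true) xs) ≡ sumWhere p g xs
    foldr-filter≡sumWhere p g []       = ≡.refl
    foldr-filter≡sumWhere p g (x ∷ xs) with p x
    ... | true  = ≡.cong (λ s → g x + s) (foldr-filter≡sumWhere p g xs)
    ... | false = foldr-filter≡sumWhere p g xs

    sumWhere-cong : ∀ {p q : A → Bool} {g h : A → Carrier} → (∀ x → p x ≡ q x) → (∀ x → g x ≈ h x) →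
                    ∀ xs → sumWhere p g xs ≈ sumWhere q h xs
    sumWhere-cong p≗q g≈h []       = refl
    sumWhere-cong {p} {q} p≗q g≈h (x ∷ xs) with p x | q x | p≗q x
    ... | true  | .true  | ≡.refl = +-cong (g≈h x) (sumWhere-cong p≗q g≈h xs)
    ... | false | .false | ≡.refl = sumWhere-cong p≗q g≈h xs

    sumWhere-++ : ∀ p g (xs ys : List A) → sumWhere p g (xs ++ ys) ≈ sumWhere p g xs + sumWhere p g ys
    sumWhere-++ p g []       ys = sym (+-identityˡ _)
    sumWhere-++ p g (x ∷ xs) ys with p x
    ... | true  = trans (+-congˡ (sumWhere-++ p g xs ys)) (sym (+-assoc _ _ _))
    ... | false = sumWhere-++ p g xs ys

    sumWhere-map : ∀ {B : Set} p g (h : B → A) xs → sumWhere p g (map h xs) ≡ sumWhere (p ∘ h) (g ∘ h) xs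
    sumWhere-map p g h []       = ≡.refl
    sumWhere-map p g h (x ∷ xs) with p (h x)
    ... | true  = ≡.cong (λ s → g (h x) + s) (sumWhere-map p g h xs)
    ... | false = sumWhere-map p g h xs

    sumWhere-*ˡ : ∀ p g t (xs : List A) → sumWhere p (λ x → t * g x) xs ≈ t * sumWhere p g xs
    sumWhere-*ˡ p g t []       = sym (zeroʳ t)
    sumWhere-*ˡ p g t (x ∷ xs) with p x
    ... | true  = trans (+-congˡ (sumWhere-*ˡ p g t xs)) (sym (distribˡ t _ _))
    ... | false = sumWhere-*ˡ p g t xs

    sumWhere-false : ∀ g (xs : List A) → sumWhere (λ _ → false) g xs ≈ 0#
    sumWhere-false g []       = refl
    sumWhere-false g (x ∷ xs) = sumWhere-false g xs

    sumWhere-∧ˡ : ∀ b p g (xs : List A) → sumWhere (λ x → b ∧ p x) g xs ≈ (if b then sumWhere p g xs else 0#)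
    sumWhere-∧ˡ true  p g xs = refl
    sumWhere-∧ˡ false p g xs = sumWhere-false g xs

  sumBelow : ℕ → (ℕ → Carrier) → Carrier
  sumBelow zero    g = 0#
  sumBelow (suc k) g = g 0 + sumBelow k (g ∘ suc)

  sumBelow-cong : ∀ k {g h} → (∀ i → g i ≈ h i) → sumBelow k g ≈ sumBelow k h
  sumBelow-cong zero    g≈h = refl
  sumBelow-cong (suc k) g≈h = +-cong (g≈h 0) (sumBelow-cong k (g≈h ∘ suc))

  sumBelow-0 : ∀ k → sumBelow k (λ _ → 0#) ≈ 0#
  sumBelow-0 zero    = refl
  sumBelow-0 (suc k) = trans (+-identityˡ _) (sumBelow-0 k)

  sumBelow-if-∧ : ∀ k b (p : ℕ → Bool) (F : ℕ → Carrier) →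
                  sumBelow k (λ i → if b ∧ p i then F i else 0#) ≈ (if b then sumBelow k (λ i → if p i then F i else 0#) else 0#)
  sumBelow-if-∧ k true  p F = refl
  sumBelow-if-∧ k false p F = sumBelow-0 k

  sumBelow-point : ∀ {x k} → x < k → ∀ (F : ℕ → Carrier) → sumBelow k (λ i → if i ≡ᵇ x then F i else 0#) ≈ F x
  sumBelow-point {zero}  {suc k} _         F = trans (+-congˡ (sumBelow-0 k)) (+-identityʳ _)
  sumBelow-point {suc x} {suc k} (s≤s x<k) F = trans (+-identityˡ _) (sumBelow-point x<k (F ∘ suc))

  sumBelow-adjacent : ∀ {x k} → suc x < k → ∀ (F : ℕ → Carrier) →
                      sumBelow k (λ i → if (suc x ≡ᵇ i) ∨ (x ≡ᵇ i) then F i else 0#) ≈ F x + F (suc x)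
  sumBelow-adjacent {zero}  {suc (suc k)} _          F = +-congˡ (trans (+-congˡ (sumBelow-0 k)) (+-identityʳ _))
  sumBelow-adjacent {zero}  {suc zero}    (s≤s ())
  sumBelow-adjacent {suc x} {suc k}       (s≤s 1+x<k) F = trans (+-identityˡ _) (sumBelow-adjacent 1+x<k (F ∘ suc))

  sumWhere-prefixes : ∀ (p : List ℕ → Bool) (g : List ℕ → Carrier) (f : ℕ → ℕ) k (xss : List (List ℕ)) →
    sumWhere p g (concatMap (λ y → map (y ∷_) xss) (applyUpTo f k)) ≈ sumBelow k (λ i → sumWhere (p ∘ (f i ∷_)) (g ∘ (f i ∷_)) xss)
  sumWhere-prefixes p g f zero    xss = refl
  sumWhere-prefixes p g f (suc k) xss = begin
    sumWhere p g (map (f 0 ∷_) xss ++ concatMap (λ y → map (y ∷_) xss) (applyUpTo (f ∘ suc) k))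
      ≈⟨ sumWhere-++ p g (map (f 0 ∷_) xss) _ ⟩
    sumWhere p g (map (f 0 ∷_) xss) + sumWhere p g (concatMap (λ y → map (y ∷_) xss) (applyUpTo (f ∘ suc) k))
      ≈⟨ +-cong (reflexive (sumWhere-map p g (f 0 ∷_) xss)) (sumWhere-prefixes p g (f ∘ suc) k xss) ⟩
    sumBelow (suc k) (λ i → sumWhere (p ∘ (f i ∷_)) (g ∘ (f i ∷_)) xss)
      ∎
    where open import Relation.Binary.Reasoning.Setoid setoid

module RingFacts {c ℓ : Level} (R : CommutativeRing c ℓ) where
  open CommutativeRing R
  open WithRing R
  open import Algebra.Properties.CommutativeSemiring.Exp commutativeSemiring using (_^_; ^-homo-*; ^-distrib-*)

  pow≡^ : ∀ x n → pow x n ≡ x ^ n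
  pow≡^ x zero    = ≡.refl
  pow≡^ x (suc n) = ≡.cong (x *_) (pow≡^ x n)

  pow-+ : ∀ x m n → pow x (m +ℕ n) ≈ pow x m * pow x n
  pow-+ x m n rewrite pow≡^ x (m +ℕ n) | pow≡^ x m | pow≡^ x n = ^-homo-* x m n

  pow-* : ∀ x y n → pow (x * y) n ≈ pow x n * pow y n
  pow-* x y n rewrite pow≡^ (x * y) n | pow≡^ x n | pow≡^ y n = ^-distrib-* x y n

  1*x*1≈x : ∀ {x} → 1# * x * 1# ≈ x
  1*x*1≈x = trans (*-identityʳ _) (*-identityˡ _)

  *-assoc³ : ∀ u x y z → u * (x * y * z) ≈ u * x * y * z
  *-assoc³ u x y z = trans (sym (*-assoc u (x * y) z)) (*-congʳ (sym (*-assoc u x y)))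

module Chains {c ℓ : Level} (R : CommutativeRing c ℓ) (a b c' d : CommutativeRing.Carrier R) where
  open CommutativeRing R
  open WithRing R
  open Params a b c' d
  open Sums R
  open RingFacts R
  open import Algebra.Solver.Ring.NaturalCoefficients.Default commutativeSemiring using (solve; _:=_; _:+_; _:*_; con)
  open import Relation.Binary.Reasoning.Setoid setoid

  partWeight : Bool → ℕ → Carrier
  partWeight true  x = pow a ⌈ x /2⌉ * pow b ⌊ x /2⌋
  partWeight false x = pow c' ⌈ x /2⌉ * pow d ⌊ x /2⌋

  ωFrom-∷ : ∀ f x xs → ωFrom f (x ∷ xs) ≡ partWeight f x * ωFrom (not f) xs
  ωFrom-∷ true  x xs = ≡.refl
  ωFrom-∷ false x xs = ≡.refl

  -- chainSum f x m is the ω-weight of the valid chains x ∷ zs with m further parts whose head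
  -- sits at an odd position iff f.
  chainSum : Bool → ℕ → ℕ → Carrier
  chainSum f x       zero    = if validFrom f (x ∷ []) then ωFrom f (x ∷ []) else 0#
  chainSum f zero    (suc m) = 0#
  chainSum f (suc x) (suc m) =
    if parityOK f (suc x) then partWeight f (suc x) * (chainSum (not f) x m + chainSum (not f) (suc x) m) else 0#

  chainsUpTo : Bool → ℕ → ℕ → ℕ → Carrier
  chainsUpTo f x m H = sumWhere (validFrom f ∘ (x ∷_)) (ωFrom f ∘ (x ∷_)) (listsUpTo m H)

  chainsUpTo-∷ : ∀ f x y m H →
    sumWhere (validFrom f ∘ (x ∷_) ∘ (y ∷_)) (ωFrom f ∘ (x ∷_) ∘ (y ∷_)) (listsUpTo m H)
      ≈ (if linkOK f x y then partWeight f x * chainsUpTo (not f) y m H else 0#)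
  chainsUpTo-∷ f x y m H = begin
    sumWhere (validFrom f ∘ (x ∷_) ∘ (y ∷_)) (ωFrom f ∘ (x ∷_) ∘ (y ∷_)) (listsUpTo m H)
      ≈⟨ sumWhere-cong (validFrom-∷∷ f x y) (λ zs → reflexive (ωFrom-∷ f x (y ∷ zs))) (listsUpTo m H) ⟩
    sumWhere (λ zs → linkOK f x y ∧ validFrom (not f) (y ∷ zs)) (λ zs → partWeight f x * ωFrom (not f) (y ∷ zs)) (listsUpTo m H)
      ≈⟨ sumWhere-∧ˡ (linkOK f x y) _ _ (listsUpTo m H) ⟩
    (if linkOK f x y then sumWhere (validFrom (not f) ∘ (y ∷_)) (λ zs → partWeight f x * ωFrom (not f) (y ∷ zs)) (listsUpTo m H) else 0#)
      ≈⟨ if-congʳ (linkOK f x y) (sumWhere-*ˡ _ _ (partWeight f x) (listsUpTo m H)) ⟩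
    (if linkOK f x y then partWeight f x * chainsUpTo (not f) y m H else 0#)
      ∎

  chainsUpTo≈chainSum : ∀ m f x {H} → x ≤ H → chainsUpTo f x m H ≈ chainSum f x m
  chainsUpTo≈chainSum zero f x x≤H with validFrom f (x ∷ [])
  ... | true  = +-identityʳ _
  ... | false = refl
  chainsUpTo≈chainSum (suc m) f x {H} x≤H = begin
    chainsUpTo f x (suc m) H
      ≈⟨ sumWhere-prefixes _ _ (λ y → y) (suc H) (listsUpTo m H) ⟩
    sumBelow (suc H) (λ y → sumWhere (validFrom f ∘ (x ∷_) ∘ (y ∷_)) (ωFrom f ∘ (x ∷_) ∘ (y ∷_)) (listsUpTo m H))
      ≈⟨ sumBelow-cong (suc H) (λ y → chainsUpTo-∷ f x y m H) ⟩
    sumBelow (suc H) (λ y → if linkOK f x y then partWeight f x * chainsUpTo (not f) y m H else 0#)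
      ≈⟨ links x x≤H ⟩
    chainSum f x (suc m)
      ∎
    where
    links : ∀ x → x ≤ H → sumBelow (suc H) (λ y → if linkOK f x y then partWeight f x * chainsUpTo (not f) y m H else 0#)
                            ≈ chainSum f x (suc m)
    links zero    _     = sumBelow-0 (suc H)
    links (suc x) 1+x≤H = begin
      sumBelow (suc H) (λ y → if parityOK f (suc x) ∧ ((suc x ≡ᵇ y) ∨ (x ≡ᵇ y)) then t * T y else 0#)
        ≈⟨ sumBelow-if-∧ (suc H) (parityOK f (suc x)) (λ y → (suc x ≡ᵇ y) ∨ (x ≡ᵇ y)) (λ y → t * T y) ⟩
      (if parityOK f (suc x) then sumBelow (suc H) (λ y → if (suc x ≡ᵇ y) ∨ (x ≡ᵇ y) then t * T y else 0#) else 0#)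
        ≈⟨ if-congʳ (parityOK f (suc x)) (trans (sumBelow-adjacent (s≤s 1+x≤H) (λ y → t * T y)) (sym (distribˡ t _ _))) ⟩
      (if parityOK f (suc x) then t * (T x + T (suc x)) else 0#)
        ≈⟨ if-congʳ (parityOK f (suc x)) (*-congˡ (+-cong (chainsUpTo≈chainSum m (not f) x (ℕ.≤-trans (ℕ.n≤1+n x) 1+x≤H))
                                                          (chainsUpTo≈chainSum m (not f) (suc x) 1+x≤H))) ⟩
      chainSum f (suc x) (suc m)
        ∎
      where
      t : Carrier
      t = partWeight f (suc x)
      T : ℕ → Carrier
      T y = chainsUpTo (not f) y m H

  B≈chainSum : ∀ m h → B (suc m) h ≈ chainSum true h m
  B≈chainSum m h = begin
    B (suc m) h
      ≡⟨ foldr-filter≡sumWhere p ω (listsUpTo (suc m) h) ⟩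
    sumWhere p ω (listsUpTo (suc m) h)
      ≈⟨ sumWhere-prefixes p ω (λ x → x) (suc h) (listsUpTo m h) ⟩
    sumBelow (suc h) (λ x → sumWhere (p ∘ (x ∷_)) (ω ∘ (x ∷_)) (listsUpTo m h))
      ≈⟨ sumBelow-cong (suc h) top ⟩
    sumBelow (suc h) (λ x → if x ≡ᵇ h then chainsUpTo true x m h else 0#)
      ≈⟨ sumBelow-point (ℕ.n<1+n h) (λ x → chainsUpTo true x m h) ⟩
    chainsUpTo true h m h
      ≈⟨ chainsUpTo≈chainSum m true h ℕ.≤-refl ⟩
    chainSum true h m
      ∎
    where
    p : List ℕ → Bool
    p λs = inBP1 λs ∧ firstIs h λs
    top : ∀ x → sumWhere (p ∘ (x ∷_)) (ω ∘ (x ∷_)) (listsUpTo m h) ≈ (if x ≡ᵇ h then chainsUpTo true x m h else 0#)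
    top x = trans (sumWhere-cong (λ zs → ∧-comm (inBP1 (x ∷ zs)) (x ≡ᵇ h)) (λ _ → refl) (listsUpTo m h))
                  (sumWhere-∧ˡ (x ≡ᵇ h) _ _ (listsUpTo m h))

  partWeight-odd-double : ∀ k → partWeight true (double k) ≡ pow a k * pow b k
  partWeight-odd-double k = ≡.cong₂ (λ i j → pow a i * pow b j) (⌊1+double/2⌋≡n k) (⌊double/2⌋≡n k)

  partWeight-odd-1+double : ∀ k → partWeight true (suc (double k)) ≡ pow a (suc k) * pow b k
  partWeight-odd-1+double k = ≡.cong₂ (λ i j → pow a (suc i) * pow b j) (⌊double/2⌋≡n k) (⌊1+double/2⌋≡n k)

  partWeight-even-double : ∀ k → partWeight false (double k) ≡ pow c' k * pow d k
  partWeight-even-double k = ≡.cong₂ (λ i j → pow c' i * pow d j) (⌊1+double/2⌋≡n k) (⌊double/2⌋≡n k)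

  partWeight-odd-1+double≈a* : ∀ k → partWeight true (suc (double k)) ≈ a * partWeight true (double k)
  partWeight-odd-1+double≈a* k = trans (reflexive (partWeight-odd-1+double k))
                                   (trans (*-assoc a _ _) (*-congˡ (reflexive (≡.sym (partWeight-odd-double k)))))

  partWeight-double-pair : ∀ k → partWeight true (double k) * partWeight false (double k) ≈ pow Q k
  partWeight-double-pair k = begin
    partWeight true (double k) * partWeight false (double k)
      ≡⟨ ≡.cong₂ _*_ (partWeight-odd-double k) (partWeight-even-double k) ⟩
    (pow a k * pow b k) * (pow c' k * pow d k)
      ≈⟨ sym (*-assoc _ _ _) ⟩
    ((pow a k * pow b k) * pow c' k) * pow d k
      ≈⟨ sym (*-congʳ (trans (pow-* (a * b) c' k) (*-congʳ (pow-* a b k)))) ⟩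
    pow (a * b * c') k * pow d k
      ≈⟨ sym (pow-* (a * b * c') d k) ⟩
    pow Q k
      ∎

  validFrom-singleton : ∀ f x → validFrom f (x ∷ []) ≡ (1 ≤ᵇ x) ∧ parityOK f x ∧ ((x ≡ᵇ 1) ∨ (x ≡ᵇ 2))
  validFrom-singleton f     zero    = ≡.refl
  validFrom-singleton true  (suc x) = ≡.refl
  validFrom-singleton false (suc x) = ≡.cong (_∧ ((suc x ≡ᵇ 1) ∨ (suc x ≡ᵇ 2))) (∧-identityʳ (isEven (suc x)))

  chainSum-0 : ∀ f m → chainSum f 0 m ≈ 0#
  chainSum-0 f zero    = refl
  chainSum-0 f (suc m) = refl

  chainSum-3+ : ∀ f x → chainSum f (3 +ℕ x) 0 ≈ 0#
  chainSum-3+ f x = if-false (≡.trans (validFrom-singleton f (3 +ℕ x)) (∧-zeroʳ (parityOK f (3 +ℕ x))))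

  chainSum-odd-at-even : ∀ k m → chainSum false (suc (double k)) m ≈ 0#
  chainSum-odd-at-even k zero    = if-false (≡.trans (validFrom-singleton false (suc (double k)))
                                                     (≡.cong (_∧ ((suc (double k) ≡ᵇ 1) ∨ (suc (double k) ≡ᵇ 2))) (isEven-1+double k)))
  chainSum-odd-at-even k (suc m) = if-false (isEven-1+double k)

  chainSum-evenHead : ∀ k m → chainSum true (double k) (suc m) ≈ partWeight true (double k) * chainSum false (double k) m
  chainSum-evenHead zero    m = sym (trans (*-congˡ (chainSum-0 false m)) (zeroʳ _))
  chainSum-evenHead (suc k) m = *-congˡ (trans (+-congʳ (chainSum-odd-at-even k m)) (+-identityˡ _))

  chainSum-oddHead : ∀ k m → chainSum true (suc (double k)) (suc m) ≈ a * chainSum true (double k) (suc m)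
  chainSum-oddHead k m = begin
    partWeight true (suc (double k)) * (chainSum false (double k) m + chainSum false (suc (double k)) m)
      ≈⟨ *-cong (partWeight-odd-1+double≈a* k) (trans (+-congˡ (chainSum-odd-at-even k m)) (+-identityʳ _)) ⟩
    a * partWeight true (double k) * chainSum false (double k) m
      ≈⟨ trans (*-assoc _ _ _) (*-congˡ (sym (chainSum-evenHead k m))) ⟩
    a * chainSum true (double k) (suc m)
      ∎

  chainSum-recurrence : ∀ k m → chainSum true (double (suc k)) (suc (suc m))
                                  ≈ pow Q (suc k) * (chainSum true (suc (double k)) m + chainSum true (double (suc k)) m)
  chainSum-recurrence k m = begin
    chainSum true (double (suc k)) (suc (suc m))
      ≈⟨ chainSum-evenHead (suc k) (suc m) ⟩
    partWeight true (double (suc k)) * chainSum false (double (suc k)) (suc m)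
      ≈⟨ *-congˡ (if-true (isEven-double k)) ⟩
    partWeight true (double (suc k)) * (partWeight false (double (suc k)) * (chainSum true (suc (double k)) m + chainSum true (double (suc k)) m))
      ≈⟨ trans (sym (*-assoc _ _ _)) (*-congʳ (partWeight-double-pair (suc k))) ⟩
    pow Q (suc k) * (chainSum true (suc (double k)) m + chainSum true (double (suc k)) m)
      ∎

  chainSum-closedForm : ∀ i j → chainSum true (double (suc i)) (suc (double j)) ≈ pow a i * pow Q (suc i C 2 +ℕ suc j) * gauss j i
  chainSum-closedForm zero zero = begin
    chainSum true 2 1
      ≈⟨ chainSum-evenHead 1 0 ⟩
    partWeight true 2 * (partWeight false 2 * 1#)
      ≈⟨ trans (*-congˡ (*-identityʳ _)) (partWeight-double-pair 1) ⟩
    pow Q 1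
      ≈⟨ sym 1*x*1≈x ⟩
    1# * pow Q 1 * 1#
      ∎
  chainSum-closedForm (suc i) zero = begin
    chainSum true (double (suc (suc i))) 1
      ≈⟨ chainSum-evenHead (suc (suc i)) 0 ⟩
    partWeight true (double (suc (suc i))) * chainSum false (3 +ℕ suc (double i)) 0
      ≈⟨ trans (*-congˡ (chainSum-3+ false (suc (double i)))) (zeroʳ _) ⟩
    0#
      ≈⟨ sym (zeroʳ _) ⟩
    pow a (suc i) * pow Q (suc (suc i) C 2 +ℕ 1) * 0#
      ∎
  chainSum-closedForm zero (suc j) = begin
    chainSum true 2 (suc (double (suc j)))
      ≈⟨ chainSum-recurrence 0 (suc (double j)) ⟩
    pow Q 1 * (chainSum true 1 (suc (double j)) + chainSum true 2 (suc (double j)))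
      ≈⟨ *-congˡ (+-cong (trans (chainSum-oddHead 0 (double j)) (zeroʳ a)) (chainSum-closedForm 0 j)) ⟩
    pow Q 1 * (0# + 1# * pow Q (suc j) * 1#)
      ≈⟨ *-cong (*-identityʳ Q) (trans (+-identityˡ _) 1*x*1≈x) ⟩
    Q * pow Q (suc j)
      ≈⟨ sym 1*x*1≈x ⟩
    1# * pow Q (suc (suc j)) * 1#
      ∎
  chainSum-closedForm (suc i) (suc j) = begin
    chainSum true (double (suc (suc i))) (suc (double (suc j)))
      ≈⟨ chainSum-recurrence (suc i) (suc (double j)) ⟩
    Q * Q₁ * (chainSum true (suc (double (suc i))) (suc (double j)) + chainSum true (double (suc (suc i))) (suc (double j)))
      ≈⟨ *-congˡ (+-cong (trans (chainSum-oddHead (suc i) (double j)) (*-congˡ (chainSum-closedForm i j)))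
                         (trans (chainSum-closedForm (suc i) j) (*-congʳ (*-congˡ (Q-shift (suc j)))))) ⟩
    Q * Q₁ * (a * (A * S * g₀) + a * A * (Q₁ * S) * g₁)
      ≈⟨ solve 7 (λ Q Q₁ a A S g₀ g₁ → Q :* Q₁ :* (a :* (A :* S :* g₀) :+ a :* A :* (Q₁ :* S) :* g₁)
                                      := a :* A :* (Q₁ :* (Q :* S)) :* (g₀ :+ Q₁ :* g₁)) refl Q Q₁ a A S g₀ g₁ ⟩
    a * A * (Q₁ * (Q * S)) * (g₀ + Q₁ * g₁)
      ≈⟨ *-congʳ (*-congˡ (sym (trans (Q-shift (suc (suc j))) (*-congˡ (reflexive (≡.cong (pow Q) (ℕ.+-suc (suc i C 2) (suc j)))))))) ⟩
    pow a (suc i) * pow Q (suc (suc i) C 2 +ℕ suc (suc j)) * gauss (suc j) (suc i)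
      ∎
    where
    A Q₁ S g₀ g₁ : Carrier
    A = pow a i
    Q₁ = pow Q (suc i)
    S = pow Q (suc i C 2 +ℕ suc j)
    g₀ = gauss j i
    g₁ = gauss j (suc i)
    Q-shift : ∀ m → pow Q (suc (suc i) C 2 +ℕ m) ≈ Q₁ * pow Q (suc i C 2 +ℕ m)
    Q-shift m = trans (reflexive (≡.cong (pow Q) (C2-shift (suc i) m))) (pow-+ Q (suc i) _)

  K : Carrier
  K = (1# + b) * a

  chainSum-extend-step : ∀ f m → (∀ y → chainSum (not f) y (suc m) ≈ K * chainSum (not f) y m) →
                         ∀ x → chainSum f x (suc (suc m)) ≈ K * chainSum f x (suc m)
  chainSum-extend-step f m ext zero = sym (zeroʳ K)
  chainSum-extend-step f m ext (suc x) with parityOK f (suc x)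
  ... | true  = trans (*-congˡ (+-cong (ext x) (ext (suc x))))
                      (solve 4 (λ t K u v → t :* (K :* u :+ K :* v) := K :* (t :* (u :+ v))) refl (partWeight f (suc x)) K _ _)
  ... | false = sym (zeroʳ K)

  chainSum-extend₀ : ∀ x → chainSum false x 1 ≈ K * chainSum false x 0
  chainSum-extend₀ 0 = sym (zeroʳ K)
  chainSum-extend₀ 1 = sym (zeroʳ K)
  chainSum-extend₀ 2 = solve 4 (λ a b c' d →
      (c' :* con 1) :* (d :* con 1) :* ((a :* con 1) :* con 1 :* con 1 :+ (a :* con 1) :* (b :* con 1) :* con 1)
        := (con 1 :+ b) :* a :* ((c' :* con 1) :* (d :* con 1) :* con 1)) refl a b c' d
  chainSum-extend₀ 3 = sym (zeroʳ K)
  chainSum-extend₀ (suc (suc (suc (suc x)))) =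
    trans (if-≈0 (isEven x) (trans (*-congˡ (trans (+-cong (chainSum-3+ true x) (chainSum-3+ true (suc x))) (+-identityʳ 0#))) (zeroʳ _)))
          (sym (trans (*-congˡ (chainSum-3+ false (suc x))) (zeroʳ K)))

  chainSum-extendᵉ : ∀ j x → chainSum false x (suc (double j)) ≈ K * chainSum false x (double j)
  chainSum-extendᵉ zero    = chainSum-extend₀
  chainSum-extendᵉ (suc j) =
    chainSum-extend-step false (suc (double j)) (chainSum-extend-step true (double j) (chainSum-extendᵉ j))

  B-oddLength : ∀ j x → B (suc (suc (suc (double j)))) x ≈ K * B (suc (suc (double j))) x
  B-oddLength j x = begin
    B (suc (suc (suc (double j)))) x
      ≈⟨ B≈chainSum (suc (suc (double j))) x ⟩
    chainSum true x (suc (suc (double j)))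
      ≈⟨ chainSum-extend-step true (double j) (chainSum-extendᵉ j) x ⟩
    K * chainSum true x (suc (double j))
      ≈⟨ *-congˡ (sym (B≈chainSum (suc (double j)) x)) ⟩
    K * B (suc (suc (double j))) x
      ∎

  K*-assoc : ∀ A S g → K * (A * S * g) ≈ (1# + b) * (a * A) * S * g
  K*-assoc A S g = trans (*-assoc³ K A S g) (*-congʳ (*-congʳ (*-assoc (1# + b) a A)))

  B-reindex : ∀ {m m′ h h′ x} → m ≡ m′ → h ≡ h′ → B m′ h′ ≈ x → B m h ≈ x
  B-reindex ≡.refl ≡.refl B≈x = B≈x

  B-even-even : ∀ j i → B (suc (suc (double j))) (double (suc i)) ≈ pow a i * pow Q (suc i C 2 +ℕ suc j) * gauss j i
  B-even-even j i = trans (B≈chainSum (suc (double j)) (double (suc i))) (chainSum-closedForm i j)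

  B-even-odd : ∀ j i → B (suc (suc (double j))) (suc (double i)) ≈ pow a i * pow Q (i C 2 +ℕ suc j) * qbin j (+ suc i -ℤ + 2)
  B-even-odd j i = trans (B≈chainSum (suc (double j)) (suc (double i))) (trans (chainSum-oddHead i (double j)) (a*closedForm i))
    where
    -- qbin j (+ suc i -ℤ + 2) computes to 0# for i = 0 and to gauss j i′ for i = suc i′.
    a*closedForm : ∀ i → a * chainSum true (double i) (suc (double j)) ≈ pow a i * pow Q (i C 2 +ℕ suc j) * qbin j (+ suc i -ℤ + 2)
    a*closedForm zero    = trans (zeroʳ a) (sym (zeroʳ _))
    a*closedForm (suc i) = trans (*-congˡ (chainSum-closedForm i j)) (*-assoc³ a _ _ _)

  B-odd-even : ∀ j i → B (suc (suc (suc (double j)))) (double (suc i))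
                         ≈ (1# + b) * pow a (suc i) * pow Q (suc i C 2 +ℕ suc j) * gauss j i
  B-odd-even j i = trans (B-oddLength j (double (suc i))) (trans (*-congˡ (B-even-even j i)) (K*-assoc _ _ _))

  B-odd-odd : ∀ j i → B (suc (suc (suc (double j)))) (suc (double i))
                        ≈ (1# + b) * pow a (suc i) * pow Q (i C 2 +ℕ suc j) * qbin j (+ suc i -ℤ + 2)
  B-odd-odd j i = trans (B-oddLength j (suc (double i))) (trans (*-congˡ (B-even-odd j i)) (K*-assoc _ _ _))

mainTheorem8 : ∀ {c ℓ : Level} (R : CommutativeRing c ℓ) →
    let open CommutativeRing R
        open WithRing R
    in ∀ (a b c' d : Carrier) →
      let open Params a b c' d
      in ∀ (n h : ℕ) → 0 < n → 0 < h →
        (B (2 *ℕ n) (2 *ℕ h) ≈ pow a (h ∸ 1) * pow Q (h C 2 +ℕ n) * qbin (n ∸ 1) (+ h -ℤ + 1))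
        × (B (2 *ℕ n +ℕ 1) (2 *ℕ h) ≈ (1# + b) * pow a h * pow Q (h C 2 +ℕ n) * qbin (n ∸ 1) (+ h -ℤ + 1))
        × (B (2 *ℕ n) (2 *ℕ h ∸ 1) ≈ pow a (h ∸ 1) * pow Q ((h ∸ 1) C 2 +ℕ n) * qbin (n ∸ 1) (+ h -ℤ + 2))
        × (B (2 *ℕ n +ℕ 1) (2 *ℕ h ∸ 1) ≈ (1# + b) * pow a h * pow Q ((h ∸ 1) C 2 +ℕ n) * qbin (n ∸ 1) (+ h -ℤ + 2))
mainTheorem8 R a b c' d (suc n) (suc h) _ _ =
    B-reindex 2n≡ 2h≡ (B-even-even n h)
  , B-reindex 2n+1≡ 2h≡ (B-odd-even n h)
  , B-reindex 2n≡ 2h-1≡ (B-even-odd n h)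
  , B-reindex 2n+1≡ 2h-1≡ (B-odd-odd n h)
  where
  open Chains R a b c' d
  2n≡ : 2 *ℕ suc n ≡ suc (suc (double n))
  2n≡ = 2*n≡double (suc n)
  2n+1≡ : 2 *ℕ suc n +ℕ 1 ≡ suc (suc (suc (double n)))
  2n+1≡ = 2*n+1≡1+double (suc n)
  2h≡ : 2 *ℕ suc h ≡ double (suc h)
  2h≡ = 2*n≡double (suc h)
  2h-1≡ : 2 *ℕ suc h ∸ 1 ≡ suc (double h)
  2h-1≡ = ≡.cong (_∸ 1) 2h≡
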